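{- Let $s\in\mathbb{N}$ and let $R\subseteq\{0,1,\dots,s\}$ be a set with $0\in R$ and $s\in R$. Then there exists a graph $G$ such that the set of useful sizes of $G$ is exactly $R$.
   Context: All graphs are finite and simple. Power domination: given a graph $G$ and $S\subseteq V(G)$, set $B:=N[S]$ (domination step); then repeatedly, while some $x\in B$ has exactly one neighbor $y\in V(G)\setminus B$, add $y$ to $B$ (zero forcing step). The final set is the observed set $\mathrm{Obs}(G;S)$. $S$ is a power dominating set if $\mathrm{Obs}(G;S)=V(G)$, and $\gamma_P(G)$ is the minimum size of a power dominating set. For $\beta\in\mathbb{R}_{\ge 0}$ the cost function is $\mathrm{C}(G;S,\beta)=|S|+\beta\,(|V(G)|-|\mathrm{Obs}(G;S)|)$. A set $S$ is $\beta$-best if $\mathrm{C}(G;S,\beta)=\min_{S'\subseteq V(G)}\mathrm{C}(G;S',\beta)$. A set $S$ is useful for $G$ if there is a non-degenerate interval $I$ such that $S$ is $\beta$-best for every $\beta\in I$. An integer $k\in\{0,1,\dots,\gamma_P(G)\}$ is a useful size of $G$ if there is a useful set of size $k$.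
   Formalization: The parameter β of the cost function ranges over ℚ instead of $\mathbb{R}_{\ge 0}$, so the non-degenerate intervals defining useful sets have rational endpoints and contain only their rational points. -}

module Defs where

open import Data.Bool using (Bool; true; false; _∧_; _∨_; not; if_then_else_)
open import Data.Nat as ℕ using (ℕ; zero; suc; _∸_; _≡ᵇ_)
open import Data.Fin using (Fin; zero; suc)
open import Data.Integer using (+_)
open import Data.Rational using (ℚ; _/_; _+_; _*_; _≤_; _<_; 0ℚ)
open import Data.Product using (Σ; ∃; _×_; _,_)
open import Relation.Binary.PropositionalEquality using (_≡_)

record Graph : Set where
  field
    n      : ℕ
    adj    : Fin n → Fin n → Bool
    sym    : ∀ i j → adj i j ≡ adj j i
    irrefl : ∀ i → adj i i ≡ false
open Graph public

VSet : ℕ → Set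
VSet n = Fin n → Bool

count : ∀ {n} → (Fin n → Bool) → ℕ
count {zero}  p = 0
count {suc n} p = (if p zero then 1 else 0) ℕ.+ count {n} (λ i → p (suc i))

anyFin : ∀ {n} → (Fin n → Bool) → Bool
anyFin {zero}  p = false
anyFin {suc n} p = p zero ∨ anyFin {n} (λ i → p (suc i))

module _ (G : Graph) where
  private
    V = Fin (n G)
    A = adj G

  closedNbhd : VSet (n G) → VSet (n G)
  closedNbhd S v = S v ∨ anyFin (λ u → A v u ∧ S u)

  unobsNbrs : VSet (n G) → V → ℕ
  unobsNbrs B x = count (λ y → A x y ∧ not (B y))

  -- one (parallel) round of zero forcing: y is added if some x ∈ B has
  -- y as its unique neighbour outside B
  forceStep : VSet (n G) → VSet (n G)
  forceStep B y = B y ∨ anyFin (λ x → B x ∧ A x y ∧ not (B y) ∧ (unobsNbrs B x ≡ᵇ 1))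

  iter : ℕ → VSet (n G) → VSet (n G)
  iter zero    B = B
  iter (suc k) B = forceStep (iter k B)

  -- observed set Obs(G;S): |V(G)| rounds suffice to reach the closure
  Obs : VSet (n G) → VSet (n G)
  Obs S = iter (n G) (closedNbhd S)

  IsPDS : VSet (n G) → Set
  IsPDS S = ∀ v → Obs S v ≡ true

  IsPowerDomNumber : ℕ → Set
  IsPowerDomNumber γ = (Σ (VSet (n G)) λ S → IsPDS S × count S ≡ γ)
                     × (∀ S → IsPDS S → γ ℕ.≤ count S)

  ℕtoℚ : ℕ → ℚ
  ℕtoℚ k = (+ k) / 1

  cost : VSet (n G) → ℚ → ℚ
  cost S β = ℕtoℚ (count S) + β * ℕtoℚ (n G ∸ count (Obs S))

  IsBetaBest : ℚ → VSet (n G) → Set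
  IsBetaBest β S = ∀ S' → cost S β ≤ cost S' β

  IsUseful : VSet (n G) → Set
  IsUseful S = Σ ℚ λ a → Σ ℚ λ b → 0ℚ ≤ a × a < b ×
               (∀ β → a ≤ β → β ≤ b → IsBetaBest β S)

  IsUsefulSize : ℕ → Set
  IsUsefulSize k = (Σ ℕ λ γ → IsPowerDomNumber γ × k ℕ.≤ γ)
                 × (Σ (VSet (n G)) λ S → IsUseful S × count S ≡ k)

module Submission where

-- G is a disjoint union of s stars; star i (0 ≤ i < s) has one leaf for every r ∈ R with
-- i < r ≤ s, so the stars shrink, and shrink strictly right after every size r ∈ R.
-- Zero forcing never leaves a star, so k vertices observe at most P k, the number of vertices
-- of the k largest stars, and the centres of those stars observe exactly that many.  Hence
-- the cheapest set of size k costs k + β (|V| − P k), with P concave of increments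
-- d i = 1 + (leaves of star i).  Size r is optimal exactly for 1/d (r − 1) ≤ β ≤ 1/d r
-- (no lower bound for r = 0, no upper bound for r = s), a proper interval when r ∈ R; for
-- 0 < k < s with k ∉ R we have d (k − 1) = d k, which pins β to the single value 1/d k.

open import Defs
open import Data.Bool using (Bool; true; false; _∧_; _∨_; if_then_else_)
open import Data.Nat
  using (ℕ; zero; suc; _+_; _*_; _∸_; _≤_; _<_; z≤n; s≤s; s≤s⁻¹; z<s; _<?_)
open import Data.Nat.Properties
open import Data.Nat.Tactic.RingSolver using (solve-∀)
open import Data.Nat.Coprimality using (Coprime; 1-coprimeTo) renaming (sym to coprime-sym)
open import Data.Integer as ℤ using (+_)
import Data.Integer.Properties as ℤ
open import Data.Rational as ℚ using (ℚ; mkℚ; ↥_; ↧ₙ_; 0ℚ; _/_; *≤*; *<*; toℚᵘ)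
import Data.Rational.Properties as ℚ
open import Data.Rational.Properties
  using (↥p/↧p≡p; toℚᵘ-homo-+; toℚᵘ-homo-*; toℚᵘ-mono-≤; toℚᵘ-cancel-≤)
import Data.Rational.Unnormalised as ℚᵘ
import Data.Rational.Unnormalised.Properties as ℚᵘ
open import Data.Fin using (Fin; zero; suc; _↑ˡ_; _↑ʳ_; splitAt)
open import Data.Fin.Properties using (splitAt-↑ˡ; splitAt-↑ʳ; splitAt⁻¹-↑ˡ; splitAt⁻¹-↑ʳ)
open import Data.Sum using (_⊎_; inj₁; inj₂; [_,_]′)
open import Data.Product using (Σ; ∃; _×_; _,_; proj₂)
open import Data.Empty using (⊥-elim)
open import Function using (_∘_; const; _⇔_; mk⇔; Equivalence)
open import Relation.Nullary using (¬_; yes; no)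
open import Relation.Binary.PropositionalEquality
  using (_≡_; _≢_; refl; trans; cong; cong₂; subst; subst₂)
  renaming (sym to ≡-sym)

∨-introˡ : ∀ a b → a ≡ true → a ∨ b ≡ true
∨-introˡ true b _ = refl

∨-introʳ : ∀ a b → b ≡ true → a ∨ b ≡ true
∨-introʳ true  b _ = refl
∨-introʳ false b e = e

∨-elim : ∀ a b → a ∨ b ≡ true → a ≡ true ⊎ b ≡ true
∨-elim true  b _ = inj₁ refl
∨-elim false b e = inj₂ e

∧-intro : ∀ a b → a ≡ true → b ≡ true → a ∧ b ≡ true
∧-intro true true _ _ = refl

∧-elimˡ : ∀ a b → a ∧ b ≡ true → a ≡ true
∧-elimˡ true b _ = refl

∧-elimʳ : ∀ a b → a ∧ b ≡ true → b ≡ true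
∧-elimʳ true b e = e

_⊆_ : ∀ {n} → VSet n → VSet n → Set
A ⊆ B = ∀ v → A v ≡ true → B v ≡ true

anyFin-intro : ∀ {n} (p : Fin n → Bool) i → p i ≡ true → anyFin p ≡ true
anyFin-intro p zero    e = ∨-introˡ (p zero) _ e
anyFin-intro p (suc i) e = ∨-introʳ (p zero) _ (anyFin-intro (p ∘ suc) i e)

anyFin-elim : ∀ {n} (p : Fin n → Bool) → anyFin p ≡ true → ∃ λ i → p i ≡ true
anyFin-elim {suc n} p e with ∨-elim (p zero) _ e
... | inj₁ e₀ = zero , e₀
... | inj₂ e₊ with anyFin-elim (p ∘ suc) e₊
...   | i , eᵢ = suc i , eᵢ

count-none : ∀ {n} (p : Fin n → Bool) → (∀ i → p i ≡ false) → count p ≡ 0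
count-none {zero}  p h = refl
count-none {suc n} p h rewrite h zero = count-none (p ∘ suc) (h ∘ suc)

count-cong : ∀ {n} {p q : Fin n → Bool} → (∀ i → p i ≡ q i) → count p ≡ count q
count-cong {zero}  p≗q = refl
count-cong {suc n} {q = q} p≗q rewrite p≗q zero =
  cong (_+_ (if q zero then 1 else 0)) (count-cong (p≗q ∘ suc))

count-all : ∀ {n} (p : Fin n → Bool) → (∀ i → p i ≡ true) → count p ≡ n
count-all {zero}  p h = refl
count-all {suc n} p h rewrite h zero = cong suc (count-all (p ∘ suc) (h ∘ suc))

count-≤ : ∀ {n} (p : Fin n → Bool) → count p ≤ n
count-≤ {zero}  p = z≤n
count-≤ {suc n} p with p zero
... | true  = s≤s (count-≤ (p ∘ suc))
... | false = m≤n⇒m≤1+n (count-≤ (p ∘ suc))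

count-mono : ∀ {n} {p q : Fin n → Bool} → p ⊆ q → count p ≤ count q
count-mono {zero}          p⊆q = z≤n
count-mono {suc n} {p} {q} p⊆q with p zero in e₀ | q zero in f₀
... | true  | true  = s≤s (count-mono (p⊆q ∘ suc))
... | true  | false with () ← trans (≡-sym (p⊆q zero e₀)) f₀
... | false | true  = m≤n⇒m≤1+n (count-mono (p⊆q ∘ suc))
... | false | false = count-mono (p⊆q ∘ suc)

count≡n⇒all : ∀ {n} (p : Fin n → Bool) → count p ≡ n → ∀ i → p i ≡ true
count≡n⇒all {suc n} p e i with p zero in e₀
count≡n⇒all {suc n} p e zero    | true  = e₀
count≡n⇒all {suc n} p e (suc i) | true  = count≡n⇒all (p ∘ suc) (suc-injective e) i
count≡n⇒all {suc n} p e i       | false =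
  ⊥-elim (<⇒≱ (s≤s (count-≤ (p ∘ suc))) (≤-reflexive (≡-sym e)))

anyFin⇒count-pos : ∀ {n} (p : Fin n → Bool) → anyFin p ≡ true → 1 ≤ count p
anyFin⇒count-pos {suc n} p e with p zero
... | true  = s≤s z≤n
... | false = anyFin⇒count-pos (p ∘ suc) e

count-++ : ∀ m {n} (p : Fin (m + n) → Bool) →
           count p ≡ count (λ i → p (i ↑ˡ n)) + count (λ j → p (m ↑ʳ j))
count-++ zero    p = refl
count-++ (suc m) p =
  trans (cong (_+_ (if p zero then 1 else 0)) (count-++ m (p ∘ suc)))
        (≡-sym (+-assoc (if p zero then 1 else 0) _ _))

↑-elim : ∀ {a b} (P : Fin (a + b) → Set) →
         (∀ i → P (i ↑ˡ b)) → (∀ j → P (a ↑ʳ j)) → ∀ v → P v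
↑-elim {a} P left right v with splitAt a v in eq
... | inj₁ i = subst P (splitAt⁻¹-↑ˡ eq) (left i)
... | inj₂ j = subst P (splitAt⁻¹-↑ʳ eq) (right j)

-- Observation stays inside adjacency-closed sets

module _ (G : Graph) where

  Closed : VSet (n G) → Set
  Closed T = ∀ x y → adj G x y ≡ true → T x ≡ true → T y ≡ true

  iter-⊆-closed : ∀ {T} → Closed T → ∀ k {B} → B ⊆ T → iter G k B ⊆ T
  iter-⊆-closed cl zero    B⊆T = B⊆T
  iter-⊆-closed cl (suc k) {B} B⊆T y e with ∨-elim (iter G k B y) _ e
  ... | inj₁ old = iter-⊆-closed cl k B⊆T y old
  ... | inj₂ forced with anyFin-elim _ forced
  ...   | x , fx = cl x y (∧-elimˡ (adj G x y) _ (∧-elimʳ (iter G k B x) _ fx))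
                          (iter-⊆-closed cl k B⊆T x (∧-elimˡ (iter G k B x) _ fx))

  closedNbhd-⊆-closed : ∀ {T} → Closed T → ∀ {S} → S ⊆ T → closedNbhd G S ⊆ T
  closedNbhd-⊆-closed cl {S} S⊆T v e with ∨-elim (S v) _ e
  ... | inj₁ Sv = S⊆T v Sv
  ... | inj₂ nbr with anyFin-elim _ nbr
  ...   | u , vu = cl u v (trans (Graph.sym G u v) (∧-elimˡ _ _ vu)) (S⊆T u (∧-elimʳ _ _ vu))

  Obs-⊆-closed : ∀ {T} → Closed T → ∀ {S} → S ⊆ T → Obs G S ⊆ T
  Obs-⊆-closed cl S⊆T = iter-⊆-closed cl (n G) (closedNbhd-⊆-closed cl S⊆T)

  ⊆-iter : ∀ k B → B ⊆ iter G k B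
  ⊆-iter zero    B v e = e
  ⊆-iter (suc k) B v e = ∨-introˡ _ _ (⊆-iter k B v e)

  closedNbhd-⊆-Obs : ∀ S → closedNbhd G S ⊆ Obs G S
  closedNbhd-⊆-Obs S = ⊆-iter (n G) (closedNbhd G S)

closedNbhd-homo : ∀ {G H} {S : VSet (n G)} {S' : VSet (n H)} (f : Fin (n G) → Fin (n H)) →
                  (∀ i j → adj G i j ≡ true → adj H (f i) (f j) ≡ true) →
                  (∀ i → S i ≡ true → S' (f i) ≡ true) →
                  ∀ i → closedNbhd G S i ≡ true → closedNbhd H S' (f i) ≡ true
closedNbhd-homo {G} {H} {S} {S'} f f-adj f-S i e with ∨-elim (S i) _ e
... | inj₁ Si = ∨-introˡ _ _ (f-S i Si)
... | inj₂ nbr with anyFin-elim _ nbr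
...   | u , iu = ∨-introʳ (S' (f i)) _
                   (anyFin-intro (λ w → adj H (f i) w ∧ S' w) (f u)
                      (∧-intro _ _ (f-adj i u (∧-elimˡ _ _ iu)) (f-S u (∧-elimʳ _ _ iu))))

emptyGraph : Graph
emptyGraph = record { n = 0 ; adj = λ () ; sym = λ () ; irrefl = λ () }

isCentre : ∀ {l} → Fin (suc l) → Bool
isCentre zero    = true
isCentre (suc _) = false

adjStar : ∀ {l} → Fin (suc l) → Fin (suc l) → Bool
adjStar zero    zero    = false
adjStar zero    (suc _) = true
adjStar (suc _) zero    = true
adjStar (suc _) (suc _) = false

star : ℕ → Graph
star l = record { n = suc l ; adj = adjStar ; sym = adjStar-sym ; irrefl = adjStar-irrefl }
  where
  adjStar-sym : ∀ (i j : Fin (suc l)) → adjStar i j ≡ adjStar j i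
  adjStar-sym zero    zero    = refl
  adjStar-sym zero    (suc _) = refl
  adjStar-sym (suc _) zero    = refl
  adjStar-sym (suc _) (suc _) = refl
  adjStar-irrefl : ∀ (i : Fin (suc l)) → adjStar i i ≡ false
  adjStar-irrefl zero    = refl
  adjStar-irrefl (suc _) = refl

adjSum : ∀ {a b} → (Fin a → Fin a → Bool) → (Fin b → Fin b → Bool) →
         Fin a ⊎ Fin b → Fin a ⊎ Fin b → Bool
adjSum A B (inj₁ x) (inj₁ y) = A x y
adjSum A B (inj₁ _) (inj₂ _) = false
adjSum A B (inj₂ _) (inj₁ _) = false
adjSum A B (inj₂ x) (inj₂ y) = B x y

infixr 5 _⊕_

_⊕_ : Graph → Graph → Graph
G ⊕ H = record
  { n      = n G + n H
  ; adj    = λ i j → adjSum (adj G) (adj H) (splitAt (n G) i) (splitAt (n G) j)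
  ; sym    = λ i j → adjSum-sym (splitAt (n G) i) (splitAt (n G) j)
  ; irrefl = λ i → adjSum-irrefl (splitAt (n G) i)
  }
  where
  adjSum-sym : ∀ x y → adjSum (adj G) (adj H) x y ≡ adjSum (adj G) (adj H) y x
  adjSum-sym (inj₁ x) (inj₁ y) = Graph.sym G x y
  adjSum-sym (inj₁ _) (inj₂ _) = refl
  adjSum-sym (inj₂ _) (inj₁ _) = refl
  adjSum-sym (inj₂ x) (inj₂ y) = Graph.sym H x y
  adjSum-irrefl : ∀ x → adjSum (adj G) (adj H) x x ≡ false
  adjSum-irrefl (inj₁ x) = Graph.irrefl G x
  adjSum-irrefl (inj₂ x) = Graph.irrefl H x

joinSet : ∀ {a b} → VSet a → VSet b → VSet (a + b)
joinSet {a} T₁ T₂ = [ T₁ , T₂ ]′ ∘ splitAt a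

module _ {a b} (T₁ : VSet a) (T₂ : VSet b) where

  joinSet-↑ˡ : ∀ i → joinSet T₁ T₂ (i ↑ˡ b) ≡ T₁ i
  joinSet-↑ˡ i rewrite splitAt-↑ˡ a i b = refl

  joinSet-↑ʳ : ∀ j → joinSet T₁ T₂ (a ↑ʳ j) ≡ T₂ j
  joinSet-↑ʳ j rewrite splitAt-↑ʳ a b j = refl

  count-joinSet : count (joinSet T₁ T₂) ≡ count T₁ + count T₂
  count-joinSet = trans (count-++ a (joinSet T₁ T₂))
    (cong₂ _+_ (count-cong joinSet-↑ˡ) (count-cong joinSet-↑ʳ))

module _ (G H : Graph) where

  adj-↑ˡ : ∀ i j → adj (G ⊕ H) (i ↑ˡ n H) (j ↑ˡ n H) ≡ adj G i j
  adj-↑ˡ i j rewrite splitAt-↑ˡ (n G) i (n H) | splitAt-↑ˡ (n G) j (n H) = refl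

  adj-↑ʳ : ∀ i j → adj (G ⊕ H) (n G ↑ʳ i) (n G ↑ʳ j) ≡ adj H i j
  adj-↑ʳ i j rewrite splitAt-↑ʳ (n G) (n H) i | splitAt-↑ʳ (n G) (n H) j = refl

  Closed-joinSet : ∀ {T₁ T₂} → Closed G T₁ → Closed H T₂ → Closed (G ⊕ H) (joinSet T₁ T₂)
  Closed-joinSet cl₁ cl₂ x y xy Tx with splitAt (n G) x | splitAt (n G) y
  ... | inj₁ x' | inj₁ y' = cl₁ x' y' xy Tx
  ... | inj₂ x' | inj₂ y' = cl₂ x' y' xy Tx

  closedNbhd-⊕ : ∀ S₁ S₂ →
                 joinSet (closedNbhd G S₁) (closedNbhd H S₂) ⊆ closedNbhd (G ⊕ H) (joinSet S₁ S₂)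
  closedNbhd-⊕ S₁ S₂ = ↑-elim _ left right
    where
    N₁ = closedNbhd G S₁
    N₂ = closedNbhd H S₂
    S = joinSet S₁ S₂
    left : ∀ i → joinSet N₁ N₂ (i ↑ˡ n H) ≡ true → closedNbhd (G ⊕ H) S (i ↑ˡ n H) ≡ true
    left i e = closedNbhd-homo {G} {G ⊕ H} {S₁} (_↑ˡ n H) (λ i j → trans (adj-↑ˡ i j))
                 (λ i → trans (joinSet-↑ˡ S₁ S₂ i)) i (trans (≡-sym (joinSet-↑ˡ N₁ N₂ i)) e)
    right : ∀ j → joinSet N₁ N₂ (n G ↑ʳ j) ≡ true → closedNbhd (G ⊕ H) S (n G ↑ʳ j) ≡ true
    right j e = closedNbhd-homo {H} {G ⊕ H} {S₂} (n G ↑ʳ_) (λ i j → trans (adj-↑ʳ i j))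
                  (λ j → trans (joinSet-↑ʳ S₁ S₂ j)) j (trans (≡-sym (joinSet-↑ʳ N₁ N₂ j)) e)

-- Star forests

Nonincreasing : (ℕ → ℕ) → Set
Nonincreasing f = ∀ i → f (suc i) ≤ f i

nonincreasing-≤ : ∀ {f} → Nonincreasing f → ∀ {i j} → i ≤ j → f j ≤ f i
nonincreasing-≤ f↓ {j = zero}  z≤n = ≤-refl
nonincreasing-≤ f↓ {i} {suc j} i≤1+j with m≤n⇒m<n∨m≡n i≤1+j
... | inj₁ i<1+j = ≤-trans (f↓ j) (nonincreasing-≤ f↓ (s≤s⁻¹ i<1+j))
... | inj₂ refl  = ≤-refl

starForest : (ℕ → ℕ) → ℕ → Graph
starForest l zero    = emptyGraph
starForest l (suc t) = star (l 0) ⊕ starForest (l ∘ suc) t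

firstStars : (ℕ → ℕ) → ℕ → ℕ → ℕ
firstStars l zero    c       = 0
firstStars l (suc t) zero    = 0
firstStars l (suc t) (suc c) = suc (l 0) + firstStars (l ∘ suc) t c

n-starForest : ∀ l t → n (starForest l t) ≡ firstStars l t t
n-starForest l zero    = refl
n-starForest l (suc t) = cong (_+_ (suc (l 0))) (n-starForest (l ∘ suc) t)

firstStars-mono : ∀ l t {c c'} → c ≤ c' → firstStars l t c ≤ firstStars l t c'
firstStars-mono l zero    _         = z≤n
firstStars-mono l (suc t) z≤n       = z≤n
firstStars-mono l (suc t) (s≤s c≤c') = +-monoʳ-≤ (suc (l 0)) (firstStars-mono (l ∘ suc) t c≤c')

firstStars-shift : ∀ {l} → Nonincreasing l → ∀ t c → firstStars (l ∘ suc) t c ≤ firstStars l (suc t) c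
firstStars-shift l↓ zero    c       = z≤n
firstStars-shift l↓ (suc t) zero    = z≤n
firstStars-shift l↓ (suc t) (suc c) = +-mono-≤ (s≤s (l↓ 0)) (firstStars-shift (l↓ ∘ suc) t c)

firstStars-step : ∀ l t k → k < t → firstStars l t (suc k) ≡ firstStars l t k + suc (l k)
firstStars-step l (suc zero)    zero    _ = +-identityʳ (suc (l 0))
firstStars-step l (suc (suc t)) zero    _ = +-identityʳ (suc (l 0))
firstStars-step l (suc t)       (suc k) (s≤s k<t) =
  trans (cong (_+_ (suc (l 0))) (firstStars-step (l ∘ suc) t k k<t)) (≡-sym (+-assoc (suc (l 0)) _ _))

firstStars-flat : ∀ l t k → t ≤ k → firstStars l t (suc k) ≡ firstStars l t k
firstStars-flat l zero    k       _         = refl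
firstStars-flat l (suc t) (suc k) (s≤s t≤k) = cong (_+_ (suc (l 0))) (firstStars-flat (l ∘ suc) t k t≤k)

firstStars-< : ∀ l t c → c < t → firstStars l t c < firstStars l t t
firstStars-< l (suc t) zero    _         = s≤s z≤n
firstStars-< l (suc t) (suc c) (s≤s c<t) = +-monoʳ-< (suc (l 0)) (firstStars-< (l ∘ suc) t c c<t)

firstStars-cons : ∀ {l} → Nonincreasing l → ∀ t c₁ c₂ {x} → (c₁ ≡ 0 → x ≡ 0) → x ≤ suc (l 0) →
                  x + firstStars (l ∘ suc) t c₂ ≤ firstStars l (suc t) (c₁ + c₂)
firstStars-cons     l↓ t zero     c₂ x≡0 _  rewrite x≡0 refl = firstStars-shift l↓ t c₂
firstStars-cons {l} l↓ t (suc c₁) c₂ _   x≤ = +-mono-≤ x≤ (firstStars-mono (l ∘ suc) t (m≤n+m c₂ c₁))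

count-anyFin-empty : ∀ {m k} (p : Fin k → Bool) → count p ≡ 0 → count {m} (const (anyFin p)) ≡ 0
count-anyFin-empty {m} p empty with anyFin p in hit
... | true  = ⊥-elim (<⇒≱ (anyFin⇒count-pos p hit) (≤-reflexive empty))
... | false = count-none {m} (const false) (λ _ → refl)

BoundedClosedCover : ∀ l t → VSet (n (starForest l t)) → Set
BoundedClosedCover l t S = Σ (VSet (n (starForest l t))) λ T →
  S ⊆ T × Closed (starForest l t) T × count T ≤ firstStars l t (count S)

starForest-closedCover : ∀ {l} → Nonincreasing l → ∀ t S → BoundedClosedCover l t S
starForest-closedCover     l↓ zero    S = S , (λ _ e → e) , (λ ()) , z≤n
starForest-closedCover {l} l↓ (suc t) S = extend (starForest-closedCover (l↓ ∘ suc) t S₂)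
  where
  rest = starForest (l ∘ suc) t
  S₁ : VSet (suc (l 0))
  S₁ i = S (i ↑ˡ n rest)
  S₂ : VSet (n rest)
  S₂ j = S (suc (l 0) ↑ʳ j)
  T₁ : VSet (suc (l 0))
  T₁ = const (anyFin S₁)

  extend : BoundedClosedCover (l ∘ suc) t S₂ → BoundedClosedCover l (suc t) S
  extend (T₂ , S₂⊆T₂ , T₂-closed , T₂-bound) =
    joinSet T₁ T₂ , S⊆T , Closed-joinSet (star (l 0)) rest (λ _ _ _ e → e) T₂-closed , bound
    where
    S⊆T : S ⊆ joinSet T₁ T₂
    S⊆T = ↑-elim _
      (λ i e → trans (joinSet-↑ˡ T₁ T₂ i) (anyFin-intro S₁ i e))
      (λ j e → trans (joinSet-↑ʳ T₁ T₂ j) (S₂⊆T₂ j e))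
    bound : count (joinSet T₁ T₂) ≤ firstStars l (suc t) (count S)
    bound = begin
      count (joinSet T₁ T₂)                          ≡⟨ count-joinSet T₁ T₂ ⟩
      count T₁ + count T₂                            ≤⟨ +-monoʳ-≤ (count T₁) T₂-bound ⟩
      count T₁ + firstStars (l ∘ suc) t (count S₂)   ≤⟨ firstStars-cons l↓ t (count S₁) (count S₂)
                                                          (count-anyFin-empty {suc (l 0)} S₁) (count-≤ T₁) ⟩
      firstStars l (suc t) (count S₁ + count S₂)     ≡⟨ cong (firstStars l (suc t)) (count-++ (suc (l 0)) S) ⟨
      firstStars l (suc t) (count S)                 ∎
      where open ≤-Reasoning

count-Obs-starForest-≤ : ∀ {l} → Nonincreasing l → ∀ t S →
                         count (Obs (starForest l t) S) ≤ firstStars l t (count S)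
count-Obs-starForest-≤ l↓ t S with starForest-closedCover l↓ t S
... | T , S⊆T , T-closed , T-bound = ≤-trans (count-mono (Obs-⊆-closed _ T-closed S⊆T)) T-bound

centres : ∀ l t → ℕ → VSet (n (starForest l t))
centres l zero    c       = λ ()
centres l (suc t) zero    = const false
centres l (suc t) (suc c) = joinSet isCentre (centres (l ∘ suc) t c)

count-centres : ∀ l t c → c ≤ t → count (centres l t c) ≡ c
count-centres l zero    zero    _         = refl
count-centres l (suc t) zero    _         = count-none {n (starForest l (suc t))} (const false) (λ _ → refl)
count-centres l (suc t) (suc c) (s≤s c≤t) =
  trans (count-joinSet {suc (l 0)} isCentre (centres (l ∘ suc) t c))
        (cong₂ _+_ (cong suc (count-none (isCentre {l 0} ∘ suc) (λ _ → refl)))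
                   (count-centres (l ∘ suc) t c c≤t))

firstStars-≤-closedNbhd-centres : ∀ l t c →
                                  firstStars l t c ≤ count (closedNbhd (starForest l t) (centres l t c))
firstStars-≤-closedNbhd-centres l zero    c       = z≤n
firstStars-≤-closedNbhd-centres l (suc t) zero    = z≤n
firstStars-≤-closedNbhd-centres l (suc t) (suc c) = begin
  suc (l 0) + firstStars (l ∘ suc) t c         ≤⟨ +-mono-≤ (≤-reflexive (≡-sym (count-all N₁ centre-dominates)))
                                                            (firstStars-≤-closedNbhd-centres (l ∘ suc) t c) ⟩
  count N₁ + count N₂                          ≡⟨ ≡-sym (count-joinSet N₁ N₂) ⟩
  count (joinSet N₁ N₂)                        ≤⟨ count-mono (closedNbhd-⊕ (star (l 0)) rest isCentre C) ⟩
  count (closedNbhd (starForest l (suc t)) (joinSet isCentre C)) ∎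
  where
  open ≤-Reasoning
  rest = starForest (l ∘ suc) t
  C = centres (l ∘ suc) t c
  N₁ = closedNbhd (star (l 0)) isCentre
  N₂ = closedNbhd rest C
  centre-dominates : ∀ i → N₁ i ≡ true
  centre-dominates zero    = refl
  centre-dominates (suc i) = refl

centres-PDS : ∀ l t → IsPDS (starForest l t) (centres l t t)
centres-PDS l t = count≡n⇒all (Obs F C) (≤-antisym (count-≤ (Obs F C)) n≤count)
  where
  F = starForest l t
  C = centres l t t
  n≤count : n F ≤ count (Obs F C)
  n≤count = begin
    n F                       ≡⟨ n-starForest l t ⟩
    firstStars l t t          ≤⟨ firstStars-≤-closedNbhd-centres l t t ⟩
    count (closedNbhd F C)    ≤⟨ count-mono (closedNbhd-⊆-Obs F C) ⟩
    count (Obs F C)           ∎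
    where open ≤-Reasoning

PDS-size : ∀ {l} → Nonincreasing l → ∀ t S → IsPDS (starForest l t) S → t ≤ count S
PDS-size {l} l↓ t S S-PDS with count S <? t
... | no  |S|≮t = ≮⇒≥ |S|≮t
... | yes |S|<t = ⊥-elim (<⇒≱ (firstStars-< l t (count S) |S|<t) (begin
    firstStars l t t                   ≡⟨ n-starForest l t ⟨
    n (starForest l t)                 ≡⟨ count-all (Obs (starForest l t) S) S-PDS ⟨
    count (Obs (starForest l t) S)     ≤⟨ count-Obs-starForest-≤ l↓ t S ⟩
    firstStars l t (count S)           ∎))
  where open ≤-Reasoning

starForest-powerDomNumber : ∀ {l} → Nonincreasing l → ∀ t → IsPowerDomNumber (starForest l t) t
starForest-powerDomNumber {l} l↓ t =
  (centres l t t , centres-PDS l t , count-centres l t t ≤-refl) , PDS-size l↓ t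

-- Optimal sizes for a concave observation profile

module _ (P : ℕ → ℕ) (q p : ℕ) where

  -- At price β = p / q this is q · (k + β (N − P k)) ≤ q · (c + β (N − P c)) with the
  -- common term β N cancelled: size k is at least as cheap as size c.
  NoWorse : ℕ → ℕ → Set
  NoWorse k c = q * k + p * P c ≤ q * c + p * P k

  private
    shuffle : ∀ q c x → q * c + x + q ≡ q * suc c + x
    shuffle = solve-∀

  noWorse-stepʳ : ∀ {k c} → NoWorse k c → p * P (suc c) ≤ p * P c + q → NoWorse k (suc c)
  noWorse-stepʳ {k} {c} k≼c rise = begin
    q * k + p * P (suc c)     ≤⟨ +-monoʳ-≤ (q * k) rise ⟩
    q * k + (p * P c + q)     ≡⟨ +-assoc (q * k) _ q ⟨
    q * k + p * P c + q       ≤⟨ +-monoˡ-≤ q k≼c ⟩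
    q * c + p * P k + q       ≡⟨ shuffle q c (p * P k) ⟩
    q * suc c + p * P k       ∎
    where open ≤-Reasoning

  noWorse-stepˡ : ∀ {k c} → NoWorse k (suc c) → q + p * P c ≤ p * P (suc c) → NoWorse k c
  noWorse-stepˡ {k} {c} k≼c+1 fall = +-cancelʳ-≤ q _ _ (begin
    q * k + p * P c + q       ≡⟨ +-assoc (q * k) _ q ⟩
    q * k + (p * P c + q)     ≡⟨ cong (_+_ (q * k)) (+-comm (p * P c) q) ⟩
    q * k + (q + p * P c)     ≤⟨ +-monoʳ-≤ (q * k) fall ⟩
    q * k + p * P (suc c)     ≤⟨ k≼c+1 ⟩
    q * suc c + p * P k       ≡⟨ shuffle q c (p * P k) ⟨
    q * c + p * P k + q       ∎)
    where open ≤-Reasoning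

  noWorse-suc⇒ : ∀ {k} → NoWorse k (suc k) → p * P (suc k) ≤ p * P k + q
  noWorse-suc⇒ {k} k≼k+1 = +-cancelˡ-≤ (q * k) _ _ (begin
    q * k + p * P (suc k)     ≤⟨ k≼k+1 ⟩
    q * suc k + p * P k       ≡⟨ shuffle q k (p * P k) ⟨
    q * k + p * P k + q       ≡⟨ +-assoc (q * k) _ q ⟩
    q * k + (p * P k + q)     ∎)
    where open ≤-Reasoning

  noWorse-pred⇒ : ∀ {c} → NoWorse (suc c) c → q + p * P c ≤ p * P (suc c)
  noWorse-pred⇒ {c} c+1≼c = +-cancelˡ-≤ (q * c) _ _ (begin
    q * c + (q + p * P c)     ≡⟨ cong (_+_ (q * c)) (+-comm q (p * P c)) ⟩
    q * c + (p * P c + q)     ≡⟨ +-assoc (q * c) _ q ⟨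
    q * c + p * P c + q       ≡⟨ shuffle q c (p * P c) ⟩
    q * suc c + p * P c       ≤⟨ c+1≼c ⟩
    q * c + p * P (suc c)     ∎)
    where open ≤-Reasoning

  noWorse-upward : ∀ {k} → (∀ c → k ≤ c → p * P (suc c) ≤ p * P c + q) → ∀ c → k ≤ c → NoWorse k c
  noWorse-upward rise c k≤c with m≤n⇒m<n∨m≡n k≤c
  noWorse-upward rise (suc c) _ | inj₁ (s≤s k≤c) = noWorse-stepʳ (noWorse-upward rise c k≤c) (rise c k≤c)
  noWorse-upward rise c       _ | inj₂ refl      = ≤-refl

  noWorse-downward : ∀ {k} → (∀ c → c < k → q + p * P c ≤ p * P (suc c)) →
                     ∀ {d} c → c + d ≡ k → NoWorse k c
  noWorse-downward     fall {zero}  c c+0≡k rewrite +-identityʳ c | c+0≡k = ≤-refl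
  noWorse-downward {k} fall {suc d} c c+1+d≡k =
    noWorse-stepˡ (noWorse-downward fall (suc c) (trans (≡-sym (+-suc c d)) c+1+d≡k))
                  (fall c (subst (c <_) c+1+d≡k (m<m+n c z<s)))

  noWorse-global : ∀ {k} → (∀ c → k ≤ c → p * P (suc c) ≤ p * P c + q) →
                   (∀ c → c < k → q + p * P c ≤ p * P (suc c)) → ∀ c → NoWorse k c
  noWorse-global {k} rise fall c with ≤-total k c
  ... | inj₁ k≤c = noWorse-upward rise c k≤c
  ... | inj₂ c≤k = noWorse-downward fall c (proj₂ (m≤n⇒∃[o]m+o≡n c≤k))

module SlopeBounds (P d : ℕ → ℕ) (s : ℕ) (d↓ : Nonincreasing d)
         (P-step : ∀ k → k < s → P (suc k) ≡ P k + d k)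
         (P-flat : ∀ k → s ≤ k → P (suc k) ≡ P k)
         (q p : ℕ) where

  noWorse-from-slopes : ∀ {r} → r ≤ s → (r < s → p * d r ≤ q) → (∀ {r'} → r ≡ suc r' → q ≤ p * d r') →
                        ∀ c → NoWorse P q p r c
  noWorse-from-slopes {r} r≤s below above = noWorse-global P q p rise fall
    where
    rise : ∀ c → r ≤ c → p * P (suc c) ≤ p * P c + q
    rise c r≤c with c <? s
    ... | yes c<s rewrite P-step c c<s | *-distribˡ-+ p (P c) (d c) =
      +-monoʳ-≤ (p * P c) (≤-trans (*-monoʳ-≤ p (nonincreasing-≤ d↓ r≤c)) (below (≤-<-trans r≤c c<s)))
    ... | no  c≮s rewrite P-flat c (≮⇒≥ c≮s) = m≤m+n (p * P c) q
    fall : ∀ c → c < r → q + p * P c ≤ p * P (suc c)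
    fall c c<r with m≤n⇒∃[o]m+o≡n c<r
    ... | o , c+1+o≡r rewrite P-step c (<-≤-trans c<r r≤s) | *-distribˡ-+ p (P c) (d c) =
      ≤-trans (≤-reflexive (+-comm q (p * P c)))
        (+-monoʳ-≤ (p * P c) (≤-trans (above (≡-sym c+1+o≡r))
                                      (*-monoʳ-≤ p (nonincreasing-≤ d↓ (m≤m+n c o)))))

  slope-≤-of-noWorse : ∀ {k} → k < s → NoWorse P q p k (suc k) → p * d k ≤ q
  slope-≤-of-noWorse {k} k<s k≼k+1 = +-cancelˡ-≤ (p * P k) _ _ (begin
    p * P k + p * d k   ≡⟨ *-distribˡ-+ p (P k) (d k) ⟨
    p * (P k + d k)     ≡⟨ cong (p *_) (P-step k k<s) ⟨
    p * P (suc k)       ≤⟨ noWorse-suc⇒ P q p k≼k+1 ⟩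
    p * P k + q         ∎)
    where open ≤-Reasoning

  slope-≥-of-noWorse : ∀ {k} → k < s → NoWorse P q p (suc k) k → q ≤ p * d k
  slope-≥-of-noWorse {k} k<s k+1≼k = +-cancelˡ-≤ (p * P k) _ _ (begin
    p * P k + q         ≡⟨ +-comm (p * P k) q ⟩
    q + p * P k         ≤⟨ noWorse-pred⇒ P q p k+1≼k ⟩
    p * P (suc k)       ≡⟨ cong (p *_) (P-step k k<s) ⟩
    p * (P k + d k)     ≡⟨ *-distribˡ-+ p (P k) (d k) ⟩
    p * P k + p * d k   ∎)
    where open ≤-Reasoning

exchange : ∀ q p {k c u v u' v'} → u' + v' ≤ u + v →
           q * k + p * u ≤ q * c + p * u' → q * k + p * v' ≤ q * c + p * v
exchange q p {k} {c} {u} {v} {u'} {v'} budget le = +-cancelʳ-≤ (p * u) _ _ (begin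
  q * k + p * v' + p * u       ≡⟨ shuffle₁ (q * k) (p * v') (p * u) ⟩
  q * k + p * u + p * v'       ≤⟨ +-monoˡ-≤ (p * v') le ⟩
  q * c + p * u' + p * v'      ≡⟨ shuffle₂ q p c u' v' ⟩
  q * c + p * (u' + v')        ≤⟨ +-monoʳ-≤ (q * c) (*-monoʳ-≤ p budget) ⟩
  q * c + p * (u + v)          ≡⟨ shuffle₃ q p c u v ⟩
  q * c + p * v + p * u        ∎)
  where
  open ≤-Reasoning
  shuffle₁ : ∀ x y z → x + y + z ≡ x + z + y
  shuffle₁ = solve-∀
  shuffle₂ : ∀ q p c u v → q * c + p * u + p * v ≡ q * c + p * (u + v)
  shuffle₂ = solve-∀
  shuffle₃ : ∀ q p c u v → q * c + p * (u + v) ≡ q * c + p * v + p * u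
  shuffle₃ = solve-∀

-- Costs at a nonnegative rational price

num : ℚ → ℕ
num β = ℤ.∣ ↥ β ∣

den : ℚ → ℕ
den β = ↧ₙ β

private
  +*+ : ∀ m n → + m ℤ.* + n ≡ + (m * n)
  +*+ m n = ≡-sym (ℤ.pos-* m n)

  ℕ/1-toℚᵘ : ∀ k → toℚᵘ (+ k / 1) ≡ ℚᵘ.mkℚᵘ (+ k) 0
  ℕ/1-toℚᵘ k = cong toℚᵘ (↥p/↧p≡p (mkℚ (+ k) 0 (coprime-sym (1-coprimeTo k))))

  cost-toℚᵘ : ∀ a b p d .(cp : Coprime p (suc d)) →
              toℚᵘ (+ a / 1 ℚ.+ mkℚ (+ p) d cp ℚ.* (+ b / 1)) ℚᵘ.≃ ℚᵘ.mkℚᵘ (+ (suc d * a + p * b)) d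
  cost-toℚᵘ a b p d cp = begin
    toℚᵘ (a/1 ℚ.+ β ℚ.* b/1)                          ≈⟨ toℚᵘ-homo-+ a/1 (β ℚ.* b/1) ⟩
    toℚᵘ a/1 ℚᵘ.+ toℚᵘ (β ℚ.* b/1)                    ≈⟨ ℚᵘ.+-congʳ (toℚᵘ a/1) (toℚᵘ-homo-* β b/1) ⟩
    toℚᵘ a/1 ℚᵘ.+ toℚᵘ β ℚᵘ.* toℚᵘ b/1                ≡⟨ cong₂ (λ x y → x ℚᵘ.+ toℚᵘ β ℚᵘ.* y)
                                                                (ℕ/1-toℚᵘ a) (ℕ/1-toℚᵘ b) ⟩
    ℚᵘ.mkℚᵘ (+ a) 0 ℚᵘ.+ ℚᵘ.mkℚᵘ (+ p) d ℚᵘ.* ℚᵘ.mkℚᵘ (+ b) 0  ≈⟨ ℚᵘ.*≡* cross-multiplied ⟩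
    ℚᵘ.mkℚᵘ (+ (suc d * a + p * b)) d                 ∎
    where
    open ℚᵘ.≃-Reasoning
    β = mkℚ (+ p) d cp
    a/1 = + a / 1
    b/1 = + b / 1
    cross-multiplied : (+ a ℤ.* + (suc d * 1) ℤ.+ (+ p ℤ.* + b) ℤ.* + 1) ℤ.* + suc d
                       ≡ + (suc d * a + p * b) ℤ.* + (1 * (suc d * 1))
    cross-multiplied rewrite +*+ a (suc d * 1) | +*+ p b | +*+ (p * b) 1
                           | +*+ (a * (suc d * 1) + p * b * 1) (suc d)
                           | +*+ (suc d * a + p * b) (1 * (suc d * 1))
                           = cong +_ (ring a b p d)
      where
      ring : ∀ a b p d → (a * (suc d * 1) + p * b * 1) * suc d ≡ (suc d * a + p * b) * (1 * (suc d * 1))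
      ring = solve-∀

  mkℚᵘ-≤⇔ : ∀ x y d → ℚᵘ.mkℚᵘ (+ x) d ℚᵘ.≤ ℚᵘ.mkℚᵘ (+ y) d ⇔ x ≤ y
  mkℚᵘ-≤⇔ x y d = mk⇔
    (λ { (ℚᵘ.*≤* le) → *-cancelʳ-≤ x y (suc d)
                           (ℤ.drop‿+≤+ (subst₂ ℤ._≤_ (+*+ x (suc d)) (+*+ y (suc d)) le)) })
    (λ le → ℚᵘ.*≤* (subst₂ ℤ._≤_ (≡-sym (+*+ x (suc d))) (≡-sym (+*+ y (suc d)))
                                 (ℤ.+≤+ (*-monoˡ-≤ (suc d) le))))

cost-≤⇔ : ∀ β → 0ℚ ℚ.≤ β → ∀ a b a' b' →
          (+ a / 1 ℚ.+ β ℚ.* (+ b / 1) ℚ.≤ + a' / 1 ℚ.+ β ℚ.* (+ b' / 1)) ⇔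
          (den β * a + num β * b ≤ den β * a' + num β * b')
cost-≤⇔ (mkℚ (+ p) d cp) _ a b a' b' = mk⇔
  (λ le → Equivalence.to (mkℚᵘ-≤⇔ _ _ d)
            (ℚᵘ.≤-respˡ-≃ lhs (ℚᵘ.≤-respʳ-≃ rhs (toℚᵘ-mono-≤ le))))
  (λ le → toℚᵘ-cancel-≤
            (ℚᵘ.≤-respˡ-≃ (ℚᵘ.≃-sym lhs)
              (ℚᵘ.≤-respʳ-≃ (ℚᵘ.≃-sym rhs) (Equivalence.from (mkℚᵘ-≤⇔ _ _ d) le))))
  where
  lhs = cost-toℚᵘ a b p d cp
  rhs = cost-toℚᵘ a' b' p d cp
cost-≤⇔ (mkℚ ℤ.-[1+ _ ] _ _) (*≤* ()) _ _ _ _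

1/suc : ℕ → ℚ
1/suc m = mkℚ (+ 1) m (1-coprimeTo (suc m))

0<1/suc : ∀ m → 0ℚ ℚ.< 1/suc m
0<1/suc m = *<* (ℤ.+<+ (s≤s z≤n))

1/suc-decreasing : ∀ m → 1/suc (suc m) ℚ.< 1/suc m
1/suc-decreasing m = *<* (subst₂ ℤ._<_ (≡-sym (+*+ 1 (suc m))) (≡-sym (+*+ 1 (suc (suc m))))
                                     (ℤ.+<+ (*-monoʳ-< 1 (n<1+n (suc m)))))

≤-1/suc : ∀ {β} m → 0ℚ ℚ.≤ β → β ℚ.≤ 1/suc m → num β * suc m ≤ den β
≤-1/suc {mkℚ (+ p) d _} m _ (*≤* le) =
  ≤-trans (ℤ.drop‿+≤+ (subst₂ ℤ._≤_ (+*+ p (suc m)) (+*+ 1 (suc d)) le))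
          (≤-reflexive (*-identityˡ (suc d)))
≤-1/suc {mkℚ ℤ.-[1+ _ ] _ _} m (*≤* ()) _

1/suc-≤ : ∀ {β} m → 0ℚ ℚ.≤ β → 1/suc m ℚ.≤ β → den β ≤ num β * suc m
1/suc-≤ {mkℚ (+ p) d _} m _ (*≤* le) =
  ≤-trans (≤-reflexive (≡-sym (*-identityˡ (suc d))))
          (ℤ.drop‿+≤+ (subst₂ ℤ._≤_ (+*+ 1 (suc d)) (+*+ p (suc m)) le))
1/suc-≤ {mkℚ ℤ.-[1+ _ ] _ _} m (*≤* ()) _

den≡num*-≮ : ∀ {α β} m → 0ℚ ℚ.≤ α → 0ℚ ℚ.≤ β → den α ≡ num α * m → den β ≡ num β * m → ¬ α ℚ.< β
den≡num*-≮ {mkℚ (+ p) _ _} {mkℚ (+ p') _ _} m _ _ α≡ β≡ (*<* lt) =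
  <-irrefl (swap p p' m) (subst₂ _<_ (cong (p *_) β≡) (cong (p' *_) α≡)
                                      (ℤ.drop‿+<+ (subst₂ ℤ._<_ (+*+ p _) (+*+ p' _) lt)))
  where
  swap : ∀ x y z → x * (y * z) ≡ y * (x * z)
  swap = solve-∀
den≡num*-≮ {mkℚ ℤ.-[1+ _ ] _ _} m (*≤* ()) _ _ _ _
den≡num*-≮ {mkℚ (+ _) _ _} {mkℚ ℤ.-[1+ _ ] _ _} m _ (*≤* ()) _ _ _

-- The star forest realising R

countFrom : (ℕ → Bool) → ℕ → ℕ → ℕ
countFrom R j zero    = 0
countFrom R j (suc t) = (if R j then 1 else 0) + countFrom R (suc j) t

leaves : (ℕ → Bool) → ℕ → ℕ → ℕ
leaves R s i = countFrom R (suc i) (s ∸ i)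

module _ (R : ℕ → Bool) (s : ℕ) where

  leaves-step : ∀ i → i < s → leaves R s i ≡ (if R (suc i) then 1 else 0) + leaves R s (suc i)
  leaves-step i i<s = cong (countFrom R (suc i)) (+-∸-assoc 1 i<s)

  leaves-nonincreasing : Nonincreasing (leaves R s)
  leaves-nonincreasing i with i <? s
  ... | yes i<s rewrite leaves-step i i<s = m≤n+m _ _
  ... | no  i≮s rewrite m≤n⇒m∸n≡0 (m≤n⇒m≤1+n (≮⇒≥ i≮s)) = z≤n

module UsefulSizes (s : ℕ) (R : ℕ → Bool) where

  l : ℕ → ℕ
  l = leaves R s

  l↓ : Nonincreasing l
  l↓ = leaves-nonincreasing R s

  G : Graph
  G = starForest l s

  P : ℕ → ℕ
  P = firstStars l s

  unobserved : VSet (n G) → ℕ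
  unobserved S = n G ∸ count (Obs G S)

  budget-≥ : ∀ S → n G ≤ unobserved S + P (count S)
  budget-≥ S = begin
    n G                                  ≡⟨ m∸n+n≡m (count-≤ (Obs G S)) ⟨
    unobserved S + count (Obs G S)       ≤⟨ +-monoʳ-≤ (unobserved S) (count-Obs-starForest-≤ l↓ s S) ⟩
    unobserved S + P (count S)           ∎
    where open ≤-Reasoning

  budget-centres : ∀ c → unobserved (centres l s c) + P c ≤ n G
  budget-centres c = begin
    unobserved C + P c                   ≤⟨ +-monoʳ-≤ (unobserved C) (firstStars-≤-closedNbhd-centres l s c) ⟩
    unobserved C + count (closedNbhd G C) ≤⟨ +-monoʳ-≤ (unobserved C) (count-mono (closedNbhd-⊆-Obs G C)) ⟩
    unobserved C + count (Obs G C)       ≡⟨ m∸n+n≡m (count-≤ (Obs G C)) ⟩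
    n G                                  ∎
    where
    open ≤-Reasoning
    C = centres l s c

  best⇒noWorse : ∀ {β S} → 0ℚ ℚ.≤ β → IsBetaBest G β S → ∀ c → c ≤ s →
                 NoWorse P (den β) (num β) (count S) c
  best⇒noWorse {β} {S} 0≤β best c c≤s = exchange (den β) (num β) budget scaled
    where
    C = centres l s c
    budget : unobserved C + P c ≤ unobserved S + P (count S)
    budget = ≤-trans (budget-centres c) (budget-≥ S)
    scaled : den β * count S + num β * unobserved S ≤ den β * c + num β * unobserved C
    scaled = subst (λ x → den β * count S + num β * unobserved S ≤ den β * x + num β * unobserved C)
                   (count-centres l s c c≤s)
                   (Equivalence.to (cost-≤⇔ β 0≤β _ _ _ _) (best C))

  noWorse⇒best : ∀ {β r} → 0ℚ ℚ.≤ β → r ≤ s → (∀ c → NoWorse P (den β) (num β) r c) →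
                 IsBetaBest G β (centres l s r)
  noWorse⇒best {β} {r} 0≤β r≤s r-optimal S' =
    Equivalence.from (cost-≤⇔ β 0≤β _ _ _ _)
      (subst (λ x → den β * x + num β * unobserved C ≤ den β * count S' + num β * unobserved S')
             (≡-sym (count-centres l s r r≤s))
             (exchange (den β) (num β) budget (r-optimal (count S'))))
    where
    C = centres l s r
    budget : P r + unobserved C ≤ P (count S') + unobserved S'
    budget = subst₂ _≤_ (+-comm (unobserved C) (P r)) (+-comm (unobserved S') (P (count S')))
                        (≤-trans (budget-centres r) (budget-≥ S'))

  module Slopes (β : ℚ) = SlopeBounds P (suc ∘ l) s (s≤s ∘ l↓)
                                       (firstStars-step l s) (firstStars-flat l s) (den β) (num β)

  centres-best : ∀ {β r} → 0ℚ ℚ.≤ β → r ≤ s → (r < s → num β * suc (l r) ≤ den β) →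
                 (∀ {r'} → r ≡ suc r' → den β ≤ num β * suc (l r')) → IsBetaBest G β (centres l s r)
  centres-best {β} 0≤β r≤s below above =
    noWorse⇒best 0≤β r≤s (Slopes.noWorse-from-slopes β r≤s below above)

  centres-useful : ∀ r → r ≤ s → R r ≡ true → IsUseful G (centres l s r)
  centres-useful zero    _   _  = 0ℚ , 1/suc (l 0) , ℚ.≤-refl , 0<1/suc (l 0) ,
    λ β 0≤β β≤b → centres-best 0≤β z≤n (λ _ → ≤-1/suc (l 0) 0≤β β≤b) (λ ())
  centres-useful (suc r) r<s Rr = 1/suc (l r) , 1/suc (l (suc r)) , 0≤a , a<b , best
    where
    0≤a : 0ℚ ℚ.≤ 1/suc (l r)
    0≤a = ℚ.<⇒≤ (0<1/suc (l r))
    a<b : 1/suc (l r) ℚ.< 1/suc (l (suc r))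
    a<b rewrite leaves-step R s r r<s | Rr = 1/suc-decreasing (l (suc r))
    best : ∀ β → 1/suc (l r) ℚ.≤ β → β ℚ.≤ 1/suc (l (suc r)) → IsBetaBest G β (centres l s (suc r))
    best β a≤β β≤b =
      centres-best 0≤β r<s (λ _ → ≤-1/suc (l (suc r)) 0≤β β≤b) λ { refl → 1/suc-≤ (l r) 0≤β a≤β }
      where
      0≤β = ℚ.≤-trans 0≤a a≤β

  best⇒den≡ : ∀ {β S k} → 0ℚ ℚ.≤ β → IsBetaBest G β S → count S ≡ suc k → suc k < s →
              R (suc k) ≡ false → den β ≡ num β * suc (l (suc k))
  best⇒den≡ {β} {S} {k} 0≤β best |S|≡1+k 1+k<s Rk = ≤-antisym den≤ den≥
    where
    noWorse : ∀ c → c ≤ s → NoWorse P (den β) (num β) (suc k) c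
    noWorse c c≤s = subst (λ x → NoWorse P (den β) (num β) x c) |S|≡1+k (best⇒noWorse 0≤β best c c≤s)
    l-flat : l k ≡ l (suc k)
    l-flat rewrite leaves-step R s k (<⇒≤ 1+k<s) | Rk = refl
    den≤ : den β ≤ num β * suc (l (suc k))
    den≤ = subst (λ x → den β ≤ num β * suc x) l-flat
                 (Slopes.slope-≥-of-noWorse β (<⇒≤ 1+k<s) (noWorse k (≤-trans (n≤1+n k) (<⇒≤ 1+k<s))))
    den≥ : num β * suc (l (suc k)) ≤ den β
    den≥ = Slopes.slope-≤-of-noWorse β 1+k<s (noWorse (suc (suc k)) 1+k<s)

  useless-size : ∀ {S k} → count S ≡ k → 0 < k → k < s → R k ≡ false → ¬ IsUseful G S
  useless-size {k = suc k} |S|≡1+k _ 1+k<s Rk (a , b , 0≤a , a<b , best) =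
    den≡num*-≮ _ 0≤a 0≤b (best⇒den≡ 0≤a (best a ℚ.≤-refl (ℚ.<⇒≤ a<b)) |S|≡1+k 1+k<s Rk)
                          (best⇒den≡ 0≤b (best b (ℚ.<⇒≤ a<b) ℚ.≤-refl) |S|≡1+k 1+k<s Rk) a<b
    where
    0≤b = ℚ.≤-trans 0≤a (ℚ.<⇒≤ a<b)

  usefulSize⇒R : ∀ k → R 0 ≡ true → R s ≡ true → IsUsefulSize G k → R k ≡ true
  usefulSize⇒R k R0 Rs ((γ , (_ , γ-min) , k≤γ) , S , S-useful , |S|≡k) with R k in Rk
  ... | true  = refl
  ... | false =
    ⊥-elim (useless-size |S|≡k (≤∧≢⇒< z≤n (differs R0)) (≤∧≢⇒< k≤s (differs Rs ∘ ≡-sym)) Rk S-useful)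
    where
    k≤s : k ≤ s
    k≤s = ≤-trans k≤γ (≤-trans (γ-min _ (centres-PDS l s)) (≤-reflexive (count-centres l s s ≤-refl)))
    differs : ∀ {j} → R j ≡ true → j ≢ k
    differs Rj refl with () ← trans (≡-sym Rj) Rk

  R⇒usefulSize : ∀ k → k ≤ s → R k ≡ true → IsUsefulSize G k
  R⇒usefulSize k k≤s Rk = (s , starForest-powerDomNumber l↓ s , k≤s) ,
                          centres l s k , centres-useful k k≤s Rk , count-centres l s k k≤s

theorem2p7 : (s : ℕ) (R : ℕ → Bool) →
    (∀ k → R k ≡ true → k ≤ s) → R 0 ≡ true → R s ≡ true →
    Σ Graph λ G → ∀ k → (IsUsefulSize G k → R k ≡ true) × (R k ≡ true → IsUsefulSize G k)
theorem2p7 s R R⊆[0,s] R0 Rs =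
  G , λ k → usefulSize⇒R k R0 Rs , λ Rk → R⇒usefulSize k (R⊆[0,s] k Rk) Rk
  where open UsefulSizes s R
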